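{- Define integers (elements of $K$) $d^\lambda_{\mu\nu}$ and $c^\lambda_{\mu\nu}$ by $g_\mu g_\nu=\sum_\lambda d^\lambda_{\mu\nu}g_\lambda$ and $g_{\lambda/\mu}=\sum_\nu c^\lambda_{\mu\nu}g_\nu$. Then (1) for all partitions $\mu,\nu$, $\sum_\lambda d^\lambda_{\mu\nu}=1$; (2) for all partitions $\mu\subset\lambda$, $\sum_\nu c^\lambda_{\mu\nu}=1$.
   Context: $K$ is a commutative ring, $\Lambda$ the ring of symmetric functions of bounded degree over $K$ in $x=(x_1,x_2,\dots)$. For partitions $\mu\subset\lambda$, a reverse plane partition of shape $\lambda/\mu$ is a filling of the boxes by positive integers weakly increasing along rows and columns; $g_{\lambda/\mu}=\sum_T\prod_i x_i^{T(i)}$ over such $T$, where $T(i)$ is the number of columns containing $i$; $g_\lambda=g_{\lambda/\emptyset}$. It is known that $g_{\lambda/\mu}\in\Lambda$ and $\{g_\lambda\}$ is a basis of $\Lambda$. -}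

module Defs where

open import Level using (Level)
open import Data.Nat using (ℕ; zero; suc; _+_; _∸_; _≤_; _≥_; _≡ᵇ_; _≤ᵇ_)
open import Data.Bool using (Bool; true; false; _∧_; _∨_; not; if_then_else_)
open import Data.List using (List; []; _∷_; map; _++_; upTo; zip; length; concatMap; foldr)
open import Data.Nat.ListAction using (sum)
open import Data.Bool.ListAction using (and; any; all)
open import Data.List.Relation.Unary.All using (All)
open import Data.List.Relation.Unary.Linked using (Linked)
open import Data.Product using (_×_; _,_; proj₁; proj₂)
open import Algebra.Bundles using (CommutativeRing)

record Partition : Set where
  constructor mkPartition
  field
    parts      : List ℕ
    decreasing : Linked _≥_ parts
    positive   : All (λ p → 1 ≤ p) parts
open Partition public

data _⊆ₗ_ : List ℕ → List ℕ → Set where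
  []⊆ : ∀ {l} → [] ⊆ₗ l
  ∷⊆  : ∀ {m l ms ls} → m ≤ l → ms ⊆ₗ ls → (m ∷ ms) ⊆ₗ (l ∷ ls)

_⊆ₚ_ : Partition → Partition → Set
μ ⊆ₚ la = parts μ ⊆ₗ parts la

-- Boxes of a skew shape λ/μ, as (row, column) pairs (0-indexed):
-- row r contains columns c with μ_r ≤ c < λ_r.

hd : List ℕ → ℕ
hd []      = 0
hd (x ∷ _) = x

tl : List ℕ → List ℕ
tl []       = []
tl (_ ∷ xs) = xs

cellsAux : ℕ → List ℕ → List ℕ → List (ℕ × ℕ)
cellsAux r μ []       = []
cellsAux r μ (l ∷ ls) =
  map (λ c → (r , hd μ + c)) (upTo (l ∸ hd μ)) ++ cellsAux (suc r) (tl μ) ls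

cells : List ℕ → List ℕ → List (ℕ × ℕ)
cells μ la = cellsAux 0 μ la

Filling : Set
Filling = List ((ℕ × ℕ) × ℕ)

words : ℕ → ℕ → List (List ℕ)
words n zero    = [] ∷ []
words n (suc k) = concatMap (λ v → map (v ∷_) (words n k)) (map suc (upTo n))

_⇒ᵇ_ : Bool → Bool → Bool
a ⇒ᵇ b = not a ∨ b

isRPP : Filling → Bool
isRPP F = all (λ p → all (λ q → check p q) F) F
  where
  check : (ℕ × ℕ) × ℕ → (ℕ × ℕ) × ℕ → Bool
  check ((r , c) , v) ((r' , c') , v') =
    (((r ≡ᵇ r') ∧ (c ≤ᵇ c')) ⇒ᵇ (v ≤ᵇ v')) ∧
    (((c ≡ᵇ c') ∧ (r ≤ᵇ r')) ⇒ᵇ (v ≤ᵇ v'))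

countᵇ : {A : Set} → (A → Bool) → List A → ℕ
countᵇ p xs = sum (map (λ x → if p x then 1 else 0) xs)

colCount : ℕ → Filling → ℕ → ℕ
colCount ncols F i =
  countᵇ (λ c → any (λ b → (proj₂ (proj₁ b) ≡ᵇ c) ∧ (proj₂ b ≡ᵇ i)) F) (upTo ncols)

-- the filling has weight x^a, a = (a₁,…,aₙ) (variables x_{n+1},… exponent 0)
hasWeight : ℕ → Filling → List ℕ → Bool
hasWeight ncols F a =
  and (map (λ ie → colCount ncols F (suc (proj₁ ie)) ≡ᵇ proj₂ ie) (zip (upTo (length a)) a))

-- Coefficient (as a natural number) of the monomial x₁^{a₁}⋯xₙ^{aₙ}
-- in g_{λ/μ}: number of reverse plane partitions of shape λ/μ of that
-- weight.  Entries of such an RPP are automatically ≤ n (any entry i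
-- occurs in at least one column, so its exponent is ≥ 1).
gSkewℕ : List ℕ → List ℕ → List ℕ → ℕ
gSkewℕ la μ a =
  countᵇ (λ w → let F = zip cs w in isRPP F ∧ hasWeight (hd la) F a)
         (words (length a) (length cs))
  where cs = cells μ la

splits : List ℕ → List (List ℕ × List ℕ)
splits []       = ([] , []) ∷ []
splits (x ∷ xs) =
  concatMap (λ i → map (λ bc → ((i ∷ proj₁ bc) , ((x ∸ i) ∷ proj₂ bc))) (splits xs))
            (upTo (suc x))

-- Coefficients in K.  An element of Λ is determined by its coefficients
-- of all monomials x^a, a : List ℕ a finite exponent vector.

module _ {c ℓ} (R : CommutativeRing c ℓ) where
  open CommutativeRing R using (Carrier; 0#; 1#) renaming (_+_ to _+ᴷ_; _*_ to _*ᴷ_)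

  ℕ→K : ℕ → Carrier
  ℕ→K zero    = 0#
  ℕ→K (suc n) = 1# +ᴷ ℕ→K n

  sumK : List Carrier → Carrier
  sumK = foldr _+ᴷ_ 0#

  gSkew : Partition → Partition → List ℕ → Carrier
  gSkew la μ a = ℕ→K (gSkewℕ (parts la) (parts μ) a)

  g : Partition → List ℕ → Carrier
  g la a = ℕ→K (gSkewℕ (parts la) [] a)

  gProd : Partition → Partition → List ℕ → Carrier
  gProd μ ν a = sumK (map (λ bc → g μ (proj₁ bc) *ᴷ g ν (proj₂ bc)) (splits a))

  combo : List (Partition × Carrier) → List ℕ → Carrier
  combo L a = sumK (map (λ ld → proj₂ ld *ᴷ g (proj₁ ld) a) L)

  coeffSum : List (Partition × Carrier) → Carrier
  coeffSum L = sumK (map proj₂ L)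

-- In one variable a reverse plane partition can only be filled with 1s, so g_{λ/μ}(x₁, 0, 0, …)
-- is the monomial x₁^c, c the number of nonempty columns of λ/μ. The specialisation
-- x₁ = 1, x₂ = x₃ = … = 0 therefore sends every g_{λ/μ}, and every product g_μ g_ν, to 1;
-- applied to the two expansions it leaves exactly the sums of their coefficients.
module Submission where

open import Defs
open import Data.Nat using (ℕ)
open import Data.List using (List)
open import Data.Product using (_×_)
open import Algebra.Bundles using (CommutativeRing)

open import Data.Bool using (Bool; true; false; not; _∧_; if_then_else_)
open import Data.Bool.Properties using (∧-identityʳ; ∨-zeroʳ; T-≡)
open import Data.Bool.ListAction using (all)
open import Data.Fin using (toℕ)
open import Data.Vec.Functional using (Vector)
open import Data.List using ([]; _∷_; [_]; map; upTo; applyUpTo; zip; length; replicate; foldr)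
open import Data.List.Properties using (concatMap-map; concatMap-pure; map-∘)
open import Data.List.Relation.Unary.All as All using (All; []; _∷_)
open import Data.Nat as Nat using (zero; suc; _∸_; _⊔_; _<_; _≡ᵇ_; _≤ᵇ_; s≤s)
import Data.Nat.Properties as Natₚ
open import Data.Product using (_,_; proj₁; proj₂)
open import Function using (Equivalence)
open import Relation.Binary.PropositionalEquality as ≡ using (_≡_; cong)

all-true : {A : Set} {f : A → Bool} {xs : List A} →
           All (λ x → f x ≡ true) xs → all f xs ≡ true
all-true []          = ≡.refl
all-true (fx ∷ rest) rewrite fx = all-true rest

isRPP-constant : ∀ v (F : Filling) → All (λ b → proj₂ b ≡ v) F → isRPP F ≡ true
isRPP-constant v F F≡v =
  all-true (All.map (λ { {(r , c) , ._} ≡.refl →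
    all-true (All.map (λ { {(r′ , c′) , ._} ≡.refl →
      both-implied ((r ≡ᵇ r′) ∧ (c ≤ᵇ c′)) ((c ≡ᵇ c′) ∧ (r ≤ᵇ r′)) }) F≡v) }) F≡v)
  where
  implied : ∀ x → (x ⇒ᵇ (v ≤ᵇ v)) ≡ true
  implied x rewrite Equivalence.to T-≡ (Natₚ.≤⇒≤ᵇ (Natₚ.≤-refl {v})) = ∨-zeroʳ (not x)

  both-implied : ∀ x y → ((x ⇒ᵇ (v ≤ᵇ v)) ∧ (y ⇒ᵇ (v ≤ᵇ v))) ≡ true
  both-implied x y rewrite implied x | implied y = ≡.refl

words-one : ∀ k → words 1 k ≡ [ replicate k 1 ]
words-one zero    = ≡.refl
words-one (suc k) rewrite words-one k = ≡.refl

constantFilling : ℕ → List (ℕ × ℕ) → Filling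
constantFilling v cs = zip cs (replicate (length cs) v)

constantFilling-entries : ∀ v cs → All (λ b → proj₂ b ≡ v) (constantFilling v cs)
constantFilling-entries v []       = []
constantFilling-entries v (_ ∷ cs) = ≡.refl ∷ constantFilling-entries v cs

nonemptyColumns : List ℕ → List ℕ → ℕ
nonemptyColumns la μ = colCount (hd la) (constantFilling 1 (cells μ la)) 1

gSkewℕ-oneVariable : ∀ la μ k →
  gSkewℕ la μ [ k ] ≡ (if nonemptyColumns la μ ≡ᵇ k then 1 else 0)
gSkewℕ-oneVariable la μ k
  rewrite words-one (length (cells μ la))
        | isRPP-constant 1 _ (constantFilling-entries 1 (cells μ la))
        | ∧-identityʳ (nonemptyColumns la μ ≡ᵇ k)
  = Natₚ.+-identityʳ _

splits-oneVariable : ∀ k → splits [ k ] ≡ map (λ i → [ i ] , [ k ∸ i ]) (upTo (suc k))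
splits-oneVariable k =
  ≡.trans (≡.sym (concatMap-map [_] (λ i → [ i ] , [ k ∸ i ]) (upTo (suc k))))
          (concatMap-pure _)

module OneVariable {c ℓ} (R : CommutativeRing c ℓ) where
  open CommutativeRing R
  open import Algebra.Properties.Semiring.Sum semiring
  open import Relation.Binary.Reasoning.Setoid setoid

  δ : ℕ → ℕ → Carrier
  δ i j = if i ≡ᵇ j then 1# else 0#

  ℕ→K-indicator : ∀ b → ℕ→K R (if b then 1 else 0) ≈ (if b then 1# else 0#)
  ℕ→K-indicator true  = +-identityʳ 1#
  ℕ→K-indicator false = refl

  gSkewℕ-oneVariable-K : ∀ la μ k → ℕ→K R (gSkewℕ la μ [ k ]) ≈ δ (nonemptyColumns la μ) k
  gSkewℕ-oneVariable-K la μ k rewrite gSkewℕ-oneVariable la μ k = ℕ→K-indicator _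

  sumK-map-applyUpTo : ∀ (f : ℕ → Carrier) h n →
    sumK R (map f (applyUpTo h n)) ≡ ∑[ i < n ] f (h (toℕ i))
  sumK-map-applyUpTo f h zero    = ≡.refl
  sumK-map-applyUpTo f h (suc n) = cong (f (h 0) +_) (sumK-map-applyUpTo f (λ i → h (suc i)) n)

  sumK-map-upTo : ∀ (f : ℕ → Carrier) n → sumK R (map f (upTo n)) ≡ ∑[ i < n ] f (toℕ i)
  sumK-map-upTo f = sumK-map-applyUpTo f (λ i → i)

  ∑-cong : ∀ n {f f′ : Vector Carrier n} → (∀ i → f i ≈ f′ i) → sum f ≈ sum f′
  ∑-cong n = sum-cong-≋

  ∑-zero : ∀ n {f : Vector Carrier n} → (∀ i → f i ≈ 0#) → sum f ≈ 0#
  ∑-zero n f≈0 = trans (∑-cong n f≈0) (sum-replicate-zero n)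

  ∑-δ : ∀ {C n} → C < n → ∑[ k < n ] δ C (toℕ k) ≈ 1#
  ∑-δ {zero}  {suc n} _ = trans (+-congˡ (sum-replicate-zero n)) (+-identityʳ 1#)
  ∑-δ {suc C} {suc n} (s≤s C<n) = trans (+-identityˡ _) (∑-δ C<n)

  ∑-δ-convolution : ∀ a b k →
    ∑[ i < suc k ] (δ a (toℕ i) * δ b (k ∸ toℕ i)) ≈ δ (a Nat.+ b) k
  ∑-δ-convolution zero b k = begin
      1# * δ b k + ∑[ i < k ] (0# * δ b (k ∸ suc (toℕ i)))
    ≈⟨ +-cong (*-identityˡ _) (∑-zero k (λ i → zeroˡ _)) ⟩
      δ b k + 0#
    ≈⟨ +-identityʳ _ ⟩
      δ b k ∎
  ∑-δ-convolution (suc a) b zero    = trans (+-identityʳ _) (zeroˡ _)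
  ∑-δ-convolution (suc a) b (suc k) =
    trans (+-congʳ (zeroˡ _)) (trans (+-identityˡ _) (∑-δ-convolution a b k))

  columns : Partition → ℕ
  columns la = nonemptyColumns (parts la) []

  g-oneVariable : ∀ la k → g R la [ k ] ≈ δ (columns la) k
  g-oneVariable la = gSkewℕ-oneVariable-K (parts la) []

  gProd-oneVariable : ∀ μ ν k → gProd R μ ν [ k ] ≈ δ (columns μ Nat.+ columns ν) k
  gProd-oneVariable μ ν k = begin
      gProd R μ ν [ k ]
    ≡⟨ cong (λ xs → sumK R (map (λ bc → g R μ (proj₁ bc) * g R ν (proj₂ bc)) xs))
            (splits-oneVariable k) ⟩
      sumK R (map (λ bc → g R μ (proj₁ bc) * g R ν (proj₂ bc))
                  (map (λ i → [ i ] , [ k ∸ i ]) (upTo (suc k))))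
    ≡⟨ cong (sumK R) (≡.sym (map-∘ (upTo (suc k)))) ⟩
      sumK R (map (λ i → g R μ [ i ] * g R ν [ k ∸ i ]) (upTo (suc k)))
    ≡⟨ sumK-map-upTo (λ i → g R μ [ i ] * g R ν [ k ∸ i ]) (suc k) ⟩
      ∑[ i < suc k ] (g R μ [ toℕ i ] * g R ν [ k ∸ toℕ i ])
    ≈⟨ ∑-cong (suc k) (λ i → *-cong (g-oneVariable μ (toℕ i)) (g-oneVariable ν (k ∸ toℕ i))) ⟩
      ∑[ i < suc k ] (δ (columns μ) (toℕ i) * δ (columns ν) (k ∸ toℕ i))
    ≈⟨ ∑-δ-convolution (columns μ) (columns ν) k ⟩
      δ (columns μ Nat.+ columns ν) k ∎

  -- Once n exceeds the degree in x₁, this is the value at x₁ = 1 of f(x₁, 0, 0, …).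
  atOne : ℕ → (List ℕ → Carrier) → Carrier
  atOne n f = ∑[ k < n ] f [ toℕ k ]

  atOne-δ : ∀ {n} (f : List ℕ → Carrier) C → (∀ k → f [ k ] ≈ δ C k) → C < n → atOne n f ≈ 1#
  atOne-δ {n} f C f≈δ C<n = trans (∑-cong n (λ k → f≈δ (toℕ k))) (∑-δ C<n)

  maxColumns : List (Partition × Carrier) → ℕ
  maxColumns = foldr (λ ld m → columns (proj₁ ld) ⊔ m) 0

  atOne-combo : ∀ {n} L → maxColumns L < n → atOne n (combo R L) ≈ coeffSum R L
  atOne-combo {n} []             _  = ∑-zero n (λ _ → refl)
  atOne-combo {n} ((la , d) ∷ L) lt = begin
      ∑[ k < n ] (d * g R la [ toℕ k ] + combo R L [ toℕ k ])
    ≈⟨ ∑-distrib-+ {n} (λ k → d * g R la [ toℕ k ]) (λ k → combo R L [ toℕ k ]) ⟩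
      ∑[ k < n ] (d * g R la [ toℕ k ]) + atOne n (combo R L)
    ≈⟨ +-cong (sym (*-distribˡ-sum {n} d (λ k → g R la [ toℕ k ])))
              (atOne-combo L (Natₚ.m⊔n<o⇒n<o (columns la) _ lt)) ⟩
      d * atOne n (g R la) + coeffSum R L
    ≈⟨ +-congʳ (*-congˡ (atOne-δ (g R la) (columns la) (g-oneVariable la)
                                 (Natₚ.m⊔n<o⇒m<o _ _ lt))) ⟩
      d * 1# + coeffSum R L
    ≈⟨ +-congʳ (*-identityʳ d) ⟩
      d + coeffSum R L ∎

  coeffSum-≈1 : ∀ (f : List ℕ → Carrier) C L → (∀ k → f [ k ] ≈ δ C k) →
                (∀ a → f a ≈ combo R L a) → coeffSum R L ≈ 1#
  coeffSum-≈1 f C L f≈δ f≈L = begin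
      coeffSum R L           ≈⟨ atOne-combo L (Natₚ.m⊔n<o⇒n<o C _ (Natₚ.n<1+n _)) ⟨
      atOne n (combo R L)    ≈⟨ ∑-cong n (λ k → f≈L [ toℕ k ]) ⟨
      atOne n f              ≈⟨ atOne-δ f C f≈δ (Natₚ.m⊔n<o⇒m<o C _ (Natₚ.n<1+n _)) ⟩
      1#                     ∎
    where n = suc (C ⊔ maxColumns L)

corollary4p3 : ∀ {c ℓ} (R : CommutativeRing c ℓ) →
    ((μ ν : Partition) (L : List (Partition × CommutativeRing.Carrier R)) →
    ((a : List ℕ) → CommutativeRing._≈_ R (gProd R μ ν a) (combo R L a)) →
    CommutativeRing._≈_ R (coeffSum R L) (CommutativeRing.1# R))
    ×
    ((la μ : Partition) → μ ⊆ₚ la → (L : List (Partition × CommutativeRing.Carrier R)) →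
    ((a : List ℕ) → CommutativeRing._≈_ R (gSkew R la μ a) (combo R L a)) →
    CommutativeRing._≈_ R (coeffSum R L) (CommutativeRing.1# R))
corollary4p3 R =
    (λ μ ν L → coeffSum-≈1 (gProd R μ ν) (columns μ Nat.+ columns ν) L (gProd-oneVariable μ ν))
  , (λ la μ _ L → coeffSum-≈1 (gSkew R la μ) (nonemptyColumns (parts la) (parts μ)) L
                              (gSkewℕ-oneVariable-K (parts la) (parts μ)))
  where open OneVariable R
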